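{- Let $\Gamma$ and $\Delta$ be multisets of formulas. (1) If $\pi$ is an $\mathbf{LK}^-$ proof of the split sequent $\Gamma;\Rightarrow\Delta;$ then $\mathrm{CNF}(\mathcal{M}(\pi))=\{\emptyset\}$. (2) If $\pi$ is an $\mathbf{LK}^-$ proof of the split sequent $;\Gamma\Rightarrow;\Delta$ then $\mathrm{CNF}(\mathcal{M}(\pi))=\emptyset$.
   Context: Propositional formulas are built from atoms and $\bot$ using $\wedge,\vee,\neg$; $\top$ abbreviates $\neg\bot\vee\bot$. A literal is an atom (counting $\bot$ as an atom), a negated atom, or $\top$. A clause is a finite set of literals and a clause set is a set of clauses. For clause sets, $\mathcal{C}\times\mathcal{D}=\{C\cup D\mid C\in\mathcal{C},D\in\mathcal{D}\}$. The map $\mathrm{CNF}$ is defined on formulas built from literals by $\wedge,\vee$: $\mathrm{CNF}(\top)=\emptyset$, $\mathrm{CNF}(\bot)=\{\emptyset\}$, $\mathrm{CNF}(\ell)=\{\{\ell\}\}$ for other literals $\ell$, $\mathrm{CNF}(A\wedge B)=\mathrm{CNF}(A)\cup\mathrm{CNF}(B)$, $\mathrm{CNF}(A\vee B)=\mathrm{CNF}(A)\times\mathrm{CNF}(B)$. $\mathbf{LK}^-$ is the cut-free sequent calculus with axioms $p\Rightarrow p$ ($p$ an atom) and $\bot\Rightarrow$, and rules weakening, contraction (left/right), $(L\wedge_1),(L\wedge_2),(R\wedge),(R\vee_1),(R\vee_2),(L\vee),(L\neg),(R\neg)$ (standard Gentzen G1 form with context multisets; $(R\wedge)$ and $(L\vee)$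 are the only binary rules). A split sequent $\Gamma_1;\Gamma_2\Rightarrow\Delta_1;\Delta_2$ is the sequent $\Gamma_1,\Gamma_2\Rightarrow\Delta_1,\Delta_2$ with formulas divided into a left side ($\Gamma_1,\Delta_1$) and a right side ($\Gamma_2,\Delta_2$); in a proof of a split sequent every sequent is split, context formulas keep their side, and auxiliary formulas lie on the same side as the main formula. The Maehara interpolant $\mathcal{M}(\pi)$: axioms $p;\Rightarrow p;$ give $\bot$, $;p\Rightarrow;p$ give $\top$, $p;\Rightarrow;p$ give $p$, $;p\Rightarrow p;$ give $\neg p$, $\bot;\Rightarrow;$ gives $\bot$, $;\bot\Rightarrow;$ gives $\top$; unary rules keep the interpolant of the premise; a binary rule with premise proofs $\pi_1,\pi_2$ gives $\mathcal{M}(\pi_1)\vee\mathcal{M}(\pi_2)$ if its main formula is on the left side and $\mathcal{M}(\pi_1)\wedge\mathcal{M}(\pi_2)$ if on the right side. -}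

module Defs where

open import Data.Nat using (ℕ)
open import Data.List using (List; []; _∷_; _++_; concatMap; map)
open import Data.List.Membership.Propositional using (_∈_)
open import Data.List.Relation.Binary.Permutation.Propositional using (_↭_)
open import Data.Product using (_×_; _,_; ∃)
open import Function.Bundles using (_⇔_)

Atom : Set
Atom = ℕ

data Formula : Set where
  atom : Atom → Formula
  ⊥f   : Formula
  _∧f_ : Formula → Formula → Formula
  _∨f_ : Formula → Formula → Formula
  ¬f_  : Formula → Formula

-- Literals: an atom (⊥ counted as an atom), a negated atom, or ⊤

data Literal : Set where
  posL    : Atom → Literal
  botL    : Literal
  negL    : Atom → Literal
  negBotL : Literal
  topL    : Literal

data LFormula : Set where
  lit  : Literal → LFormula
  _∧l_ : LFormula → LFormula → LFormula
  _∨l_ : LFormula → LFormula → LFormula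

-- Clauses and clause sets (finite sets represented by lists,
-- compared extensionally as sets)

Clause : Set
Clause = List Literal

ClauseSet : Set
ClauseSet = List Clause

_≈C_ : Clause → Clause → Set
C ≈C D = ∀ l → (l ∈ C) ⇔ (l ∈ D)

_∈CS_ : Clause → ClauseSet → Set
C ∈CS 𝒞 = ∃ λ D → (D ∈ 𝒞) × (C ≈C D)

_≈CS_ : ClauseSet → ClauseSet → Set
𝒞 ≈CS 𝒟 = ∀ C → (C ∈CS 𝒞) ⇔ (C ∈CS 𝒟)

_⊗_ : ClauseSet → ClauseSet → ClauseSet
𝒞 ⊗ 𝒟 = concatMap (λ C → map (λ D → C ++ D) 𝒟) 𝒞

CNF : LFormula → ClauseSet
CNF (lit topL) = []
CNF (lit botL) = [] ∷ []
CNF (lit (posL p)) = (posL p ∷ []) ∷ []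
CNF (lit (negL p)) = (negL p ∷ []) ∷ []
CNF (lit negBotL) = (negBotL ∷ []) ∷ []
CNF (A ∧l B) = CNF A ++ CNF B
CNF (A ∨l B) = CNF A ⊗ CNF B

-- Split sequents Γ₁;Γ₂ ⇒ Δ₁;Δ₂.  A "split context" is a pair
-- (left-side formulas , right-side formulas); multisets are lists
-- modulo the explicit exchange (permutation) rule.

data Side : Set where
  left right : Side

SCtx : Set
SCtx = List Formula × List Formula

ins : Side → Formula → SCtx → SCtx
ins left  A (Γ₁ , Γ₂) = (A ∷ Γ₁ , Γ₂)
ins right A (Γ₁ , Γ₂) = (Γ₁ , A ∷ Γ₂)

data Proof : SCtx → SCtx → Set where
  axLL : ∀ p → Proof (atom p ∷ [] , []) (atom p ∷ [] , [])
  axRR : ∀ p → Proof ([] , atom p ∷ []) ([] , atom p ∷ [])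
  axLR : ∀ p → Proof (atom p ∷ [] , []) ([] , atom p ∷ [])
  axRL : ∀ p → Proof ([] , atom p ∷ []) (atom p ∷ [] , [])
  axBotL : Proof (⊥f ∷ [] , []) ([] , [])
  axBotR : Proof ([] , ⊥f ∷ []) ([] , [])
  exch : ∀ {Γ₁ Γ₂ Δ₁ Δ₂ Γ₁' Γ₂' Δ₁' Δ₂'} →
         Γ₁ ↭ Γ₁' → Γ₂ ↭ Γ₂' → Δ₁ ↭ Δ₁' → Δ₂ ↭ Δ₂' →
         Proof (Γ₁ , Γ₂) (Δ₁ , Δ₂) → Proof (Γ₁' , Γ₂') (Δ₁' , Δ₂')
  wkL : ∀ {Γ Δ} s A → Proof Γ Δ → Proof (ins s A Γ) Δ
  wkR : ∀ {Γ Δ} s A → Proof Γ Δ → Proof Γ (ins s A Δ)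
  ctrL : ∀ {Γ Δ} s A → Proof (ins s A (ins s A Γ)) Δ → Proof (ins s A Γ) Δ
  ctrR : ∀ {Γ Δ} s A → Proof Γ (ins s A (ins s A Δ)) → Proof Γ (ins s A Δ)
  L∧₁ : ∀ {Γ Δ} s A B → Proof (ins s A Γ) Δ → Proof (ins s (A ∧f B) Γ) Δ
  L∧₂ : ∀ {Γ Δ} s A B → Proof (ins s B Γ) Δ → Proof (ins s (A ∧f B) Γ) Δ
  R∧  : ∀ {Γ Δ} s A B → Proof Γ (ins s A Δ) → Proof Γ (ins s B Δ) →
        Proof Γ (ins s (A ∧f B) Δ)
  R∨₁ : ∀ {Γ Δ} s A B → Proof Γ (ins s A Δ) → Proof Γ (ins s (A ∨f B) Δ)
  R∨₂ : ∀ {Γ Δ} s A B → Proof Γ (ins s B Δ) → Proof Γ (ins s (A ∨f B) Δ)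
  L∨  : ∀ {Γ Δ} s A B → Proof (ins s A Γ) Δ → Proof (ins s B Γ) Δ →
        Proof (ins s (A ∨f B) Γ) Δ
  L¬  : ∀ {Γ Δ} s A → Proof Γ (ins s A Δ) → Proof (ins s (¬f A) Γ) Δ
  R¬  : ∀ {Γ Δ} s A → Proof (ins s A Γ) Δ → Proof Γ (ins s (¬f A) Δ)

⊤l ⊥l : LFormula
⊤l = lit topL
⊥l = lit botL

binop : Side → LFormula → LFormula → LFormula
binop left  = _∨l_
binop right = _∧l_

M : ∀ {Γ Δ} → Proof Γ Δ → LFormula
M (axLL p) = ⊥l
M (axRR p) = ⊤l
M (axLR p) = lit (posL p)
M (axRL p) = lit (negL p)
M axBotL = ⊥l
M axBotR = ⊤l
M (exch _ _ _ _ π) = M π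
M (wkL s A π) = M π
M (wkR s A π) = M π
M (ctrL s A π) = M π
M (ctrR s A π) = M π
M (L∧₁ s A B π) = M π
M (L∧₂ s A B π) = M π
M (R∧ s A B π₁ π₂) = binop s (M π₁) (M π₂)
M (R∨₁ s A B π) = M π
M (R∨₂ s A B π) = M π
M (L∨ s A B π₁ π₂) = binop s (M π₁) (M π₂)
M (L¬ s A π) = M π
M (R¬ s A π) = M π

-- A proof whose end-sequent lies entirely on one side never applies a rule
-- on the other side: context formulas keep their side and auxiliary formulas
-- share the side of the main formula, so the other side stays empty all the
-- way up to the axioms.  Hence the interpolant of a left-only proof is built
-- from ⊥ by ∨ alone, and that of a right-only proof from ⊤ by ∧ alone; CNF
-- sends the former to {∅} and the latter to ∅.
module Submission where

open import Defs
open import Data.List using (List; []; _∷_; _++_)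
open import Data.List.Relation.Binary.Permutation.Propositional using (_↭_)
open import Data.List.Relation.Binary.Permutation.Propositional.Properties
  using (↭-empty-inv)
open import Data.Product using (_×_; _,_; proj₁; proj₂)
open import Function.Construct.Identity using (⇔-id)
open import Relation.Binary.PropositionalEquality using (_≡_; refl; cong₂)

opposite : Side → SCtx → List Formula
opposite left  = proj₂
opposite right = proj₁

neutral : Side → LFormula
neutral left  = ⊥l
neutral right = ⊤l

data Pure (s : Side) : LFormula → Set where
  neutral-pure : Pure s (neutral s)
  binop-pure   : ∀ {X Y} → Pure s X → Pure s Y → Pure s (binop s X Y)

CNF-pure : ∀ {s X} → Pure s X → CNF X ≡ CNF (neutral s)
CNF-pure         neutral-pure     = refl
CNF-pure {left}  (binop-pure p q) = cong₂ _⊗_  (CNF-pure p) (CNF-pure q)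
CNF-pure {right} (binop-pure p q) = cong₂ _++_ (CNF-pure p) (CNF-pure q)

opposite-ins⇒side : ∀ s t {A Γ} → opposite s (ins t A Γ) ≡ [] → t ≡ s
opposite-ins⇒side left  left  _ = refl
opposite-ins⇒side right right _ = refl

opposite-ins⇒opposite : ∀ s t {A Γ} →
                        opposite s (ins t A Γ) ≡ [] → opposite s Γ ≡ []
opposite-ins⇒opposite left  left  e = e
opposite-ins⇒opposite right right e = e

opposite-ins-transfer : ∀ s t {A B Γ Γ'} → opposite s (ins t A Γ) ≡ [] →
                        opposite s Γ' ≡ [] → opposite s (ins t B Γ') ≡ []
opposite-ins-transfer left  left  _ e = e
opposite-ins-transfer right right _ e = e

opposite-ins-replace : ∀ s t {A B Γ} →
                       opposite s (ins t A Γ) ≡ [] → opposite s (ins t B Γ) ≡ []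
opposite-ins-replace s t e =
  opposite-ins-transfer s t e (opposite-ins⇒opposite s t e)

opposite-↭ : ∀ s {Γ₁ Γ₂ Γ₁' Γ₂'} → Γ₁ ↭ Γ₁' → Γ₂ ↭ Γ₂' →
             opposite s (Γ₁' , Γ₂') ≡ [] → opposite s (Γ₁ , Γ₂) ≡ []
opposite-↭ left  _ p₂ refl = ↭-empty-inv p₂
opposite-↭ right p₁ _ refl = ↭-empty-inv p₁

M-pure : ∀ s {Γ Δ} (π : Proof Γ Δ) →
         opposite s Γ ≡ [] → opposite s Δ ≡ [] → Pure s (M π)
-- The remaining axiom cases (mixed axioms, or an axiom on the other side)
-- have a non-empty opposite side and are discharged by the coverage checker.
M-pure left  (axLL p) _ _ = neutral-pure
M-pure right (axRR p) _ _ = neutral-pure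
M-pure left  axBotL   _ _ = neutral-pure
M-pure right axBotR   _ _ = neutral-pure
M-pure s (exch p₁ p₂ q₁ q₂ π) eΓ eΔ =
  M-pure s π (opposite-↭ s p₁ p₂ eΓ) (opposite-↭ s q₁ q₂ eΔ)
M-pure s (wkL t A π) eΓ eΔ = M-pure s π (opposite-ins⇒opposite s t eΓ) eΔ
M-pure s (wkR t A π) eΓ eΔ = M-pure s π eΓ (opposite-ins⇒opposite s t eΔ)
M-pure s (ctrL t A π) eΓ eΔ = M-pure s π (opposite-ins-transfer s t eΓ eΓ) eΔ
M-pure s (ctrR t A π) eΓ eΔ = M-pure s π eΓ (opposite-ins-transfer s t eΔ eΔ)
M-pure s (L∧₁ t A B π) eΓ eΔ = M-pure s π (opposite-ins-replace s t eΓ) eΔ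
M-pure s (L∧₂ t A B π) eΓ eΔ = M-pure s π (opposite-ins-replace s t eΓ) eΔ
M-pure s (R∨₁ t A B π) eΓ eΔ = M-pure s π eΓ (opposite-ins-replace s t eΔ)
M-pure s (R∨₂ t A B π) eΓ eΔ = M-pure s π eΓ (opposite-ins-replace s t eΔ)
M-pure s (L¬ t A π) eΓ eΔ =
  M-pure s π (opposite-ins⇒opposite s t eΓ) (opposite-ins-transfer s t eΓ eΔ)
M-pure s (R¬ t A π) eΓ eΔ =
  M-pure s π (opposite-ins-transfer s t eΔ eΓ) (opposite-ins⇒opposite s t eΔ)
M-pure s (R∧ t A B π₁ π₂) eΓ eΔ with refl ← opposite-ins⇒side s t eΔ =
  binop-pure (M-pure s π₁ eΓ (opposite-ins-replace s s eΔ))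
             (M-pure s π₂ eΓ (opposite-ins-replace s s eΔ))
M-pure s (L∨ t A B π₁ π₂) eΓ eΔ with refl ← opposite-ins⇒side s t eΓ =
  binop-pure (M-pure s π₁ (opposite-ins-replace s s eΓ) eΔ)
             (M-pure s π₂ (opposite-ins-replace s s eΓ) eΔ)

≈CS-reflexive : ∀ {𝒞 𝒟} → 𝒞 ≡ 𝒟 → 𝒞 ≈CS 𝒟
≈CS-reflexive refl C = ⇔-id _

mainTheorem3 :
    ((Γ Δ : List Formula) (π : Proof (Γ , []) (Δ , [])) →
       CNF (M π) ≈CS ([] ∷ []))
    ×
    ((Γ Δ : List Formula) (π : Proof ([] , Γ) ([] , Δ)) →
       CNF (M π) ≈CS [])
mainTheorem3 =
  (λ Γ Δ π → ≈CS-reflexive (CNF-pure (M-pure left  π refl refl))) ,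
  (λ Γ Δ π → ≈CS-reflexive (CNF-pure (M-pure right π refl refl)))
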